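{- For integers $d$ and $k$ define $$\eta_k(2d+2,d)=\binom{d+1}{k+1}+2\binom{d}{k+1}-\binom{d-2}{k+1},\qquad \tau_k(2d+2,d)=\binom{d+1}{k+1}+\binom{d}{k+1}+\binom{d-1}{k+1}-\binom{\lceil (d+1)/2\rceil-1}{k+1}-\binom{\lceil (d+1)/2\rceil-2}{k+1},$$ $$\eta_k(2(d-1)+1,d-1)=\binom{d}{k+1}+2\binom{d-1}{k+1}-\binom{d-2}{k+1},\qquad \tau_k(2(d-1)+1,d-1)=\binom{d}{k+1}+\binom{d-1}{k+1}+\binom{d-2}{k+1}-\binom{\lceil (d-1)/2\rceil}{k+1}-\binom{\lceil (d-1)/2\rceil-1}{k+1},$$ and $\eta_{k-1},\tau_{k-1}$ by replacing $k$ with $k-1$. Then: (i) If $d\ge 9$ and $1\le k\le \lceil d/3\rceil-2$, then $\eta_k(2d+2,d)<\tau_k(2d+2,d)$. (ii) If $d\ge 9$ and $\lfloor 0.4d\rfloor\le k\le d-1$, then $\eta_k(2d+2,d)>\tau_k(2d+2,d)$. (iii) If $d\ge 6$ and $1\le k\le d-3$, then $$\binom{d-2}{k+1}-\binom{\lceil d/2\rceil-1}{k+1}-\binom{\lceil d/2\rceil-2}{k+1}-\binom{d-4}{k}-\binom{d-5}{k}>0,$$ and for $k=d-2,d-1$ this expression equals $0$. (iv) If $d\ge 4$ and $1\le k\le d-2$, then $$\eta_k(2d+2,d)<\tau_k(2(d-1)+1,d-1)+\eta_{k-1}(2(d-1)+1,d-1)+\binom{d-1}{k}+\binom{d-2}{k}.$$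 (v) If $d\ge 5$ and $1\le k\le d-2$, then $$\eta_k(2d+2,d)<\tau_k(2(d-1)+1,d-1)+\tau_{k-1}(2(d-1)+1,d-1)+\binom{d-1}{k}+\binom{d-2}{k}.$$
   Context: All quantities are integers; binomial coefficients $\binom{n}{c}$ with $0\le n<c$ are $0$. -}

module Defs where

open import Data.Nat as ℕ using (ℕ; suc; _∸_; _/_)
open import Data.Nat.Combinatorics using (_C_)
open import Data.Integer as ℤ using (ℤ; +_; _+_; _-_)

-- binomial coefficient, valued in ℤ; (n C c) = 0 when n < c
B : ℕ → ℕ → ℤ
B n c = + (n C c)

⌈_/2⌉ : ℕ → ℕ
⌈ n /2⌉ = suc n / 2

-- ηk(2d+2,d) and τk(2d+2,d)   (arguments d, k)
η₁ : ℕ → ℕ → ℤ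
η₁ d k = B (suc d) (suc k) + (+ 2) ℤ.* B d (suc k) - B (d ∸ 2) (suc k)

τ₁ : ℕ → ℕ → ℤ
τ₁ d k = B (suc d) (suc k) + B d (suc k) + B (d ∸ 1) (suc k)
         - B (⌈ suc d /2⌉ ∸ 1) (suc k) - B (⌈ suc d /2⌉ ∸ 2) (suc k)

-- ηk(2(d-1)+1,d-1) and τk(2(d-1)+1,d-1)   (arguments d, k)
η₂ : ℕ → ℕ → ℤ
η₂ d k = B d (suc k) + (+ 2) ℤ.* B (d ∸ 1) (suc k) - B (d ∸ 2) (suc k)

τ₂ : ℕ → ℕ → ℤ
τ₂ d k = B d (suc k) + B (d ∸ 1) (suc k) + B (d ∸ 2) (suc k)
         - B ⌈ d ∸ 1 /2⌉ (suc k) - B (⌈ d ∸ 1 /2⌉ ∸ 1) (suc k)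

E₃ : ℕ → ℕ → ℤ
E₃ d k = B (d ∸ 2) (suc k) - B (⌈ d /2⌉ ∸ 1) (suc k) - B (⌈ d /2⌉ ∸ 2) (suc k)
         - B (d ∸ 4) k - B (d ∸ 5) k

⌈_/3⌉ : ℕ → ℕ
⌈ n /3⌉ = (n ℕ.+ 2) / 3

module Submission where

-- After Pascal's rule each claim is an inequality between binomial coefficients in which the
-- ceiling terms occur as pairs C(h, m) + C(h − 1, m) with 2h ≤ d.  Three terms of
-- Vandermonde's convolution bound such a pair by C(2h − 2, m), and a leftover positive binomial
-- makes the inequalities (iii)–(v) strict.  Parts (i) and (ii) compare C(n, k + 1) with
-- C(n + 1, k), n = d − 2, whose ratio (n − k)(n − k + 1) / ((k + 1)(n + 1)) exceeds 4/3 when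
-- 3k + 2 ≤ n and is below 1 when 2d < 5(k + 1).  For (i) it remains to see that the pair is at
-- most a quarter of C(n, k + 1) when k ≥ 2: this is an identity for k = 2, and each further step
-- of k at least doubles the ratio; k = 1 is a direct quadratic estimate.

module BinomialEstimates where

  open import Data.Nat.Base hiding (⌈_/2⌉)
  open import Data.Nat.Properties
  import Data.Nat.Combinatorics as Comb
  open import Data.Nat.Tactic.RingSolver using (solve-∀)
  open import Data.Product using (_,_; _×_; proj₁; proj₂)
  open import Data.Sum using (_⊎_; inj₁; inj₂)
  open import Relation.Nullary using (contradiction)
  open import Relation.Binary.PropositionalEquality
  open import Data.Nat.DivMod using (_/_; _%_; m/n≡1+[m∸n]/n; m/n*n≤m; m/n≤m; m≡m%n+[m/n]*n; m%n<n)
  open import Defs using (⌈_/2⌉; ⌈_/3⌉)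

  infix 8 _C_

  -- A sealed copy of the library binomial, whose definition by division would
  -- otherwise unfold in goals.
  opaque
    _C_ : ℕ → ℕ → ℕ
    _C_ = Comb._C_

    nC0≡1 : ∀ n → n C 0 ≡ 1
    nC0≡1 n = refl

    nC1≡n : ∀ n → n C 1 ≡ n
    nC1≡n = Comb.nC1≡n

    C-pascal : ∀ n k → suc n C suc k ≡ n C k + n C suc k
    C-pascal n k = sym (Comb.nCk+nC[k+1]≡[n+1]C[k+1] n k)

    C-vanish : ∀ {n k} → n < k → n C k ≡ 0
    C-vanish = Comb.k>n⇒nCk≡0

  C-pascal₂ : ∀ n k → suc (suc n) C suc (suc k) ≡ n C k + 2 * (n C suc k) + n C suc (suc k)
  C-pascal₂ n k = begin
    suc (suc n) C suc (suc k)                              ≡⟨ C-pascal (suc n) (suc k) ⟩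
    suc n C suc k + suc n C suc (suc k)                    ≡⟨ cong₂ _+_ (C-pascal n k) (C-pascal n (suc k)) ⟩
    (n C k + n C suc k) + (n C suc k + n C suc (suc k))    ≡⟨ regroup (n C k) (n C suc k) (n C suc (suc k)) ⟩
    n C k + 2 * (n C suc k) + n C suc (suc k)                ∎
    where
    open ≡-Reasoning
    regroup : ∀ a b c → (a + b) + (b + c) ≡ a + 2 * b + c
    regroup = solve-∀

  C-pos : ∀ {n k} → k ≤ n → 0 < n C k
  C-pos {n} {zero} _ = subst (0 <_) (sym (nC0≡1 n)) z<s
  C-pos {suc n} {suc k} (s≤s k≤n) = subst (0 <_) (sym (C-pascal n k)) (≤-trans (C-pos k≤n) (m≤m+n _ _))

  nCk≤[1+n]Ck : ∀ n k → n C k ≤ suc n C k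
  nCk≤[1+n]Ck n zero = ≤-reflexive (trans (nC0≡1 n) (sym (nC0≡1 (suc n))))
  nCk≤[1+n]Ck n (suc k) = subst (n C suc k ≤_) (sym (C-pascal n k)) (m≤n+m _ _)

  C-monoˡ-≤ : ∀ k {m n} → m ≤ n → m C k ≤ n C k
  C-monoˡ-≤ k {m} m≤n with m≤n⇒∃[o]m+o≡n m≤n
  ... | t , refl = go t
    where
    go : ∀ t → m C k ≤ (m + t) C k
    go zero    = ≤-reflexive (cong (_C k) (sym (+-identityʳ m)))
    go (suc t) = ≤-trans (go t) (subst (λ z → (m + t) C k ≤ z C k) (sym (+-suc m t)) (nCk≤[1+n]Ck (m + t) k))

  C-superadditive : ∀ x y k → x C suc k + y C suc k ≤ (x + y) C suc k
  C-superadditive zero    y k = ≤-reflexive (cong (_+ y C suc k) (C-vanish z<s))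
  C-superadditive (suc x) y k = begin
    suc x C suc k + y C suc k              ≡⟨ cong (_+ y C suc k) (C-pascal x k) ⟩
    (x C k + x C suc k) + y C suc k        ≡⟨ +-assoc (x C k) _ _ ⟩
    x C k + (x C suc k + y C suc k)        ≤⟨ +-mono-≤ (C-monoˡ-≤ k (m≤m+n x y)) (C-superadditive x y k) ⟩
    (x + y) C k + (x + y) C suc k          ≡⟨ sym (C-pascal (x + y) k) ⟩
    suc (x + y) C suc k                    ∎
    where open ≤-Reasoning

  -- Three terms of Vandermonde's convolution for the split (2 + x) + y.
  C-vandermonde-≤ : ∀ x y j →
    suc (suc x) C suc (suc j) + y C suc (suc j) + 2 * (y C suc j) ≤ suc (suc (x + y)) C suc (suc j)
  C-vandermonde-≤ x y j = begin
    suc (suc x) C suc (suc j) + y C suc (suc j) + 2 * (y C suc j)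
      ≡⟨ cong (λ z → z + y C suc (suc j) + 2 * (y C suc j)) (C-pascal₂ x j) ⟩
    x C j + 2 * (x C suc j) + x C suc (suc j) + y C suc (suc j) + 2 * (y C suc j)
      ≡⟨ regroup (x C j) (x C suc j) (x C suc (suc j)) (y C suc (suc j)) (y C suc j) ⟩
    x C j + 2 * (x C suc j + y C suc j) + (x C suc (suc j) + y C suc (suc j))
      ≤⟨ +-mono-≤ (+-mono-≤ (C-monoˡ-≤ j (m≤m+n x y)) (*-monoʳ-≤ 2 (C-superadditive x y j)))
                  (C-superadditive x y (suc j)) ⟩
    (x + y) C j + 2 * ((x + y) C suc j) + (x + y) C suc (suc j)
      ≡⟨ sym (C-pascal₂ (x + y) j) ⟩
    suc (suc (x + y)) C suc (suc j) ∎
    where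
    open ≤-Reasoning
    regroup : ∀ a b c c′ b′ → a + 2 * b + c + c′ + 2 * b′ ≡ a + 2 * (b + b′) + (c + c′)
    regroup = solve-∀

  C-absorption : ∀ n k → suc k * (suc n C suc k) ≡ suc n * (n C k)
  C-absorption zero zero = cong (1 *_) (trans (nC1≡n 1) (sym (nC0≡1 0)))
  C-absorption zero (suc k) rewrite C-vanish {1} {suc (suc k)} (s≤s z<s) | C-vanish {0} {suc k} z<s = *-zeroʳ (suc (suc k))
  C-absorption (suc n) zero rewrite nC1≡n (suc (suc n)) | nC0≡1 (suc n) = trans (+-identityʳ _) (sym (*-identityʳ _))
  C-absorption (suc n) (suc k) = begin
    (2 + k) * (suc (suc n) C suc (suc k))            ≡⟨ cong ((2 + k) *_) (C-pascal (suc n) (suc k)) ⟩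
    (2 + k) * (P + Q)                                ≡⟨ expand k P Q ⟩
    P + (1 + k) * P + (2 + k) * Q                    ≡⟨ cong₂ (λ u v → P + u + v) (C-absorption n k) (C-absorption n (suc k)) ⟩
    P + (1 + n) * (n C k) + (1 + n) * (n C suc k)    ≡⟨ trans (+-assoc P _ _) (cong (P +_) (sym (*-distribˡ-+ (1 + n) (n C k) (n C suc k)))) ⟩
    P + (1 + n) * (n C k + n C suc k)                ≡⟨ cong (λ u → P + (1 + n) * u) (sym (C-pascal n k)) ⟩
    P + (1 + n) * P                                  ∎
    where
    open ≡-Reasoning
    P = suc n C suc k
    Q = suc n C suc (suc k)
    expand : ∀ k P Q → (2 + k) * (P + Q) ≡ P + (1 + k) * P + (2 + k) * Q
    expand = solve-∀

  C-ratio : ∀ n k → suc k * (n C suc k) ≡ (n ∸ k) * (n C k)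
  C-ratio n k with ≤-<-connex k n
  ... | inj₂ n<k rewrite C-vanish (m<n⇒m<1+n n<k) | m≤n⇒m∸n≡0 (<⇒≤ n<k) = *-zeroʳ (suc k)
  ... | inj₁ k≤n with m≤n⇒∃[o]m+o≡n k≤n
  ...   | m , refl = +-cancelʳ-≡ _ _ _ (begin
    suc k * ((k + m) C suc k) + suc k * ((k + m) C k)    ≡⟨ sym (*-distribˡ-+ (suc k) ((k + m) C suc k) ((k + m) C k)) ⟩
    suc k * ((k + m) C suc k + (k + m) C k)              ≡⟨ cong (suc k *_) (trans (+-comm ((k + m) C suc k) ((k + m) C k)) (sym (C-pascal (k + m) k))) ⟩
    suc k * (suc (k + m) C suc k)                        ≡⟨ C-absorption (k + m) k ⟩
    suc (k + m) * ((k + m) C k)                          ≡⟨ cong (_* ((k + m) C k)) (split k m) ⟩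
    (k + m ∸ k + suc k) * ((k + m) C k)                  ≡⟨ *-distribʳ-+ ((k + m) C k) (k + m ∸ k) (suc k) ⟩
    (k + m ∸ k) * ((k + m) C k) + suc k * ((k + m) C k)  ∎)
    where
    open ≡-Reasoning
    split : ∀ k m → suc (k + m) ≡ k + m ∸ k + suc k
    split k m rewrite m+n∸m≡n k m = trans (cong suc (+-comm k m)) (sym (+-suc m k))

  2*[1+m]C2≡[1+m]*m : ∀ m → 2 * (suc m C 2) ≡ suc m * m
  2*[1+m]C2≡[1+m]*m m = trans (C-ratio (suc m) 1) (trans (cong (m *_) (nC1≡n (suc m))) (*-comm m (suc m)))

  -- The ceiling terms of η and τ come in pairs C(h, k) + C(h − 1, k).
  C-pair : ℕ → ℕ → ℕ
  C-pair h k = h C k + (h ∸ 1) C k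

  C-pair-pascal : ∀ g k → C-pair (suc (suc g)) (suc k) ≡ C-pair (suc g) k + C-pair (suc g) (suc k)
  C-pair-pascal g k = trans (cong₂ _+_ (C-pascal (suc g) k) (C-pascal g k))
                            (regroup (suc g C k) (suc g C suc k) (g C k) (g C suc k))
    where
    regroup : ∀ a b c d → (a + b) + (c + d) ≡ (a + c) + (b + d)
    regroup = solve-∀

  C-pair[1+g]2≡g*g : ∀ g → C-pair (suc g) 2 ≡ g * g
  C-pair[1+g]2≡g*g zero    = cong₂ _+_ (C-vanish (s≤s z<s)) (C-vanish z<s)
  C-pair[1+g]2≡g*g (suc g) = begin
    C-pair (suc (suc g)) 2               ≡⟨ C-pair-pascal g 1 ⟩
    C-pair (suc g) 1 + C-pair (suc g) 2  ≡⟨ cong₂ _+_ (cong₂ _+_ (nC1≡n (suc g)) (nC1≡n g)) (C-pair[1+g]2≡g*g g) ⟩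
    (suc g + g) + g * g                  ≡⟨ square g ⟩
    suc g * suc g                        ∎
    where
    open ≡-Reasoning
    square : ∀ g → (suc g + g) + g * g ≡ suc g * suc g
    square = solve-∀

  4*C-pair[2+g]3≡[2+2g]C3 : ∀ g → 4 * C-pair (suc (suc g)) 3 ≡ (2 + (g + g)) C 3
  4*C-pair[2+g]3≡[2+2g]C3 zero    = trans (cong (4 *_) (cong₂ _+_ (C-vanish (s≤s (s≤s z<s))) (C-vanish (s≤s z<s))))
                           (sym (C-vanish (s≤s (s≤s z<s))))
  4*C-pair[2+g]3≡[2+2g]C3 (suc g) = begin
    4 * C-pair (3 + g) 3                             ≡⟨ cong (4 *_) (C-pair-pascal (suc g) 2) ⟩
    4 * (C-pair (2 + g) 2 + C-pair (2 + g) 3)        ≡⟨ *-distribˡ-+ 4 (C-pair (2 + g) 2) _ ⟩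
    4 * C-pair (2 + g) 2 + 4 * C-pair (2 + g) 3      ≡⟨ cong₂ _+_ (cong (4 *_) (C-pair[1+g]2≡g*g (suc g))) (4*C-pair[2+g]3≡[2+2g]C3 g) ⟩
    4 * (suc g * suc g) + N C 3                      ≡⟨ cong (_+ N C 3) (double-square g) ⟩
    N * N + N C 3                                    ≡⟨ cong (_+ N C 3) (sym (C-pair[1+g]2≡g*g N)) ⟩
    (suc N C 2 + N C 2) + N C 3                      ≡⟨ +-assoc (suc N C 2) _ _ ⟩
    suc N C 2 + (N C 2 + N C 3)                      ≡⟨ cong (suc N C 2 +_) (sym (C-pascal N 2)) ⟩
    suc N C 2 + suc N C 3                            ≡⟨ sym (C-pascal (suc N) 2) ⟩
    suc (suc N) C 3                                  ≡⟨ cong (_C 3) (shift g) ⟩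
    (2 + (suc g + suc g)) C 3                              ∎
    where
    open ≡-Reasoning
    N = 2 + (g + g)
    double-square : ∀ g → 4 * (suc g * suc g) ≡ (2 + (g + g)) * (2 + (g + g))
    double-square = solve-∀
    shift : ∀ g → suc (suc (2 + (g + g))) ≡ 2 + (suc g + suc g)
    shift = solve-∀

  C-pair-≤-double : ∀ a j → C-pair (suc (suc a)) (suc (suc j)) ≤ suc (suc (a + a)) C suc (suc j)
  C-pair-≤-double a j = begin
    suc (suc a) C suc (suc j) + suc a C suc (suc j)
      ≡⟨ cong (suc (suc a) C suc (suc j) +_) (trans (C-pascal a (suc j)) (+-comm (a C suc j) _)) ⟩
    suc (suc a) C suc (suc j) + (a C suc (suc j) + a C suc j)
      ≤⟨ +-monoʳ-≤ (suc (suc a) C suc (suc j)) (+-monoʳ-≤ (a C suc (suc j)) (m≤m+n (a C suc j) _)) ⟩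
    suc (suc a) C suc (suc j) + (a C suc (suc j) + 2 * (a C suc j))
      ≡⟨ sym (+-assoc (suc (suc a) C suc (suc j)) _ _) ⟩
    suc (suc a) C suc (suc j) + a C suc (suc j) + 2 * (a C suc j)
      ≤⟨ C-vandermonde-≤ a a j ⟩
    suc (suc (a + a)) C suc (suc j) ∎
    where open ≤-Reasoning

  C-pair-ratio : ∀ h j → suc j * C-pair h (suc j) ≤ (h ∸ j) * C-pair h j
  C-pair-ratio h j = begin
    suc j * (h C suc j + (h ∸ 1) C suc j)                    ≡⟨ *-distribˡ-+ (suc j) (h C suc j) _ ⟩
    suc j * h C suc j + suc j * (h ∸ 1) C suc j              ≡⟨ cong₂ _+_ (C-ratio h j) (C-ratio (h ∸ 1) j) ⟩
    (h ∸ j) * h C j + (h ∸ 1 ∸ j) * (h ∸ 1) C j              ≤⟨ +-monoʳ-≤ ((h ∸ j) * h C j) (*-monoˡ-≤ ((h ∸ 1) C j) (∸-monoˡ-≤ j (m∸n≤m h 1))) ⟩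
    (h ∸ j) * h C j + (h ∸ j) * (h ∸ 1) C j                  ≡⟨ sym (*-distribˡ-+ (h ∸ j) (h C j) _) ⟩
    (h ∸ j) * (h C j + (h ∸ 1) C j)                          ∎
    where open ≤-Reasoning

  2*[h∸j]≤n∸j : ∀ {n h} j → h + h ≤ n + j → 2 * (h ∸ j) ≤ n ∸ j
  2*[h∸j]≤n∸j {n} {h} j le with ≤-<-connex j h
  ... | inj₂ h<j rewrite m≤n⇒m∸n≡0 (<⇒≤ h<j) = z≤n
  ... | inj₁ j≤h with m≤n⇒∃[o]m+o≡n j≤h
  ...   | u , refl rewrite m+n∸m≡n j u =
    m+n≤o⇒m≤o∸n (2 * u) (+-cancelʳ-≤ j (2 * u + j) n (subst (_≤ n + j) (regroup j u) le))
    where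
    regroup : ∀ j u → (j + u) + (j + u) ≡ (2 * u + j) + j
    regroup = solve-∀

  -- From j to j + 1, n C j grows by the factor (n − j)/(j + 1) and C-pair h j by at most
  -- (h − j)/(j + 1), which is at most half of it when h + h ≤ n + j.
  C-pair-doubling : ∀ {n h c} j → c * C-pair h j ≤ n C j → h + h ≤ n + j → 2 * c * C-pair h (suc j) ≤ n C suc j
  C-pair-doubling {n} {h} {c} j hyp le = *-cancelˡ-≤ (suc j) (begin
    suc j * (2 * c * C-pair h (suc j))    ≡⟨ swap (suc j) (2 * c) (C-pair h (suc j)) ⟩
    2 * c * (suc j * C-pair h (suc j))    ≤⟨ *-monoʳ-≤ (2 * c) (C-pair-ratio h j) ⟩
    2 * c * ((h ∸ j) * C-pair h j)        ≡⟨ regroup c (h ∸ j) (C-pair h j) ⟩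
    2 * (h ∸ j) * (c * C-pair h j)        ≤⟨ *-mono-≤ (2*[h∸j]≤n∸j j le) hyp ⟩
    (n ∸ j) * n C j                       ≡⟨ sym (C-ratio n j) ⟩
    suc j * n C suc j                     ∎)
    where
    open ≤-Reasoning
    swap : ∀ a b x → a * (b * x) ≡ b * (a * x)
    swap = solve-∀
    regroup : ∀ c d x → 2 * c * (d * x) ≡ 2 * d * (c * x)
    regroup = solve-∀

  C-pair-quarter : ∀ {n h} i → 2 ≤ h → h + h ≤ n + 2 → 4 * C-pair h (3 + i) ≤ n C (3 + i)
  C-pair-quarter {h = suc zero} zero (s≤s ()) _
  C-pair-quarter {n} {suc (suc g)} zero _ le =
    subst (_≤ n C 3) (sym (4*C-pair[2+g]3≡[2+2g]C3 g)) (C-monoˡ-≤ 3 (+-cancelʳ-≤ 2 _ n (subst (_≤ n + 2) (regroup g) le)))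
    where
    regroup : ∀ g → suc (suc g) + suc (suc g) ≡ (2 + (g + g)) + 2
    regroup = solve-∀
  C-pair-quarter {n} {h} (suc i) 2≤h le = begin
    4 * C-pair h (4 + i)    ≤⟨ *-monoˡ-≤ (C-pair h (4 + i)) (m≤m+n 4 4) ⟩
    8 * C-pair h (4 + i)    ≤⟨ C-pair-doubling {c = 4} (3 + i) (C-pair-quarter i 2≤h le) (≤-trans le (+-monoʳ-≤ n (s≤s (s≤s z≤n)))) ⟩
    n C (4 + i)             ∎
    where open ≤-Reasoning

  C-proportions : ∀ k m → suc k * (k + m) C suc k ≡ m * (k + m) C k
                        × suc m * suc (k + m) C k ≡ suc (k + m) * (k + m) C k
  C-proportions k m = trans (C-ratio (k + m) k) (cong (_* (k + m) C k) (m+n∸m≡n k m)) ,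
    (begin
      suc m * suc (k + m) C k               ≡⟨ cong (_* suc (k + m) C k) (sym 1+n∸k≡1+m) ⟩
      (suc (k + m) ∸ k) * suc (k + m) C k   ≡⟨ sym (C-ratio (suc (k + m)) k) ⟩
      suc k * suc (k + m) C suc k           ≡⟨ C-absorption (k + m) k ⟩
      suc (k + m) * (k + m) C k             ∎)
    where
    open ≡-Reasoning
    1+n∸k≡1+m : suc (k + m) ∸ k ≡ suc m
    1+n∸k≡1+m = trans (cong (_∸ k) (sym (+-suc k m))) (m+n∸m≡n k (suc m))

  -- With X = q a / p and Y = s a / r, the claim c₁ Y < c₂ X amounts to c₁ p s < c₂ r q.
  <-by-proportions : ∀ {X Y a p q r s} c₁ c₂ → p * X ≡ q * a → r * Y ≡ s * a → 0 < a →
                     c₁ * (p * s) < c₂ * (r * q) → c₁ * Y < c₂ * X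
  <-by-proportions {X} {Y} {a} {p} {q} {r} {s} c₁ c₂ pX≡qa rY≡sa 0<a coeffs =
    *-cancelˡ-< (p * r) (c₁ * Y) (c₂ * X) (begin-strict
      p * r * (c₁ * Y)     ≡⟨ regroup p r c₁ Y ⟩
      c₁ * p * (r * Y)     ≡⟨ cong (c₁ * p *_) rY≡sa ⟩
      c₁ * p * (s * a)     ≡⟨ regroup′ c₁ p s a ⟩
      c₁ * (p * s) * a     <⟨ *-monoˡ-< a {{>-nonZero 0<a}} coeffs ⟩
      c₂ * (r * q) * a     ≡⟨ sym (regroup′ c₂ r q a) ⟩
      c₂ * r * (q * a)     ≡⟨ cong (c₂ * r *_) (sym pX≡qa) ⟩
      c₂ * r * (p * X)     ≡⟨ sym (regroup r p c₂ X) ⟩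
      r * p * (c₂ * X)     ≡⟨ cong (_* (c₂ * X)) (*-comm r p) ⟩
      p * r * (c₂ * X)     ∎)
    where
    open ≤-Reasoning
    regroup : ∀ p r c Y → p * r * (c * Y) ≡ c * p * (r * Y)
    regroup = solve-∀
    regroup′ : ∀ c p s a → c * p * (s * a) ≡ c * (p * s) * a
    regroup′ = solve-∀

  <-by-slack : ∀ {a b} s → a + suc s ≡ b → a < b
  <-by-slack {a} s refl = m<m+n a z<s

  C-compare : ∀ k m c₁ c₂ → c₁ * (suc k * suc (k + m)) < c₂ * (suc m * m) →
              c₁ * suc (k + m) C k < c₂ * (k + m) C suc k
  C-compare k m c₁ c₂ =
    <-by-proportions {(k + m) C suc k} {suc (k + m) C k} {(k + m) C k} {suc k} {m} {suc m} {suc (k + m)} c₁ c₂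
      (proj₁ (C-proportions k m)) (proj₂ (C-proportions k m)) (C-pos (m≤m+n k m))

  C-compare′ : ∀ k m → suc m * m < suc k * suc (k + m) → (k + m) C suc k < suc (k + m) C k
  C-compare′ k m coeffs = subst₂ _<_ (*-identityˡ _) (*-identityˡ _)
    (<-by-proportions {suc (k + m) C k} {(k + m) C suc k} {(k + m) C k} {suc m} {suc (k + m)} {suc k} {m} 1 1
      (proj₂ (C-proportions k m)) (proj₁ (C-proportions k m)) (C-pos (m≤m+n k m))
      (subst₂ _<_ (sym (*-identityˡ _)) (sym (*-identityˡ _)) coeffs))

  4*[1+n]Ck<3*nC[1+k] : ∀ n k → 3 * k + 2 ≤ n → 4 * suc n C k < 3 * n C suc k
  4*[1+n]Ck<3*nC[1+k] n k le = split-n (subst (_≤ n) (split k) le)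
    where
    split : ∀ k → 3 * k + 2 ≡ k + (2 * k + 2)
    split = solve-∀
    coeffs : ∀ k t → 4 * (suc k * suc (k + (2 * k + 2 + t))) + suc (6 * k + 5 + t * (8 * k + 11) + 3 * t * t)
                     ≡ 3 * (suc (2 * k + 2 + t) * (2 * k + 2 + t))
    coeffs = solve-∀
    split-n : ∀ {n} → k + (2 * k + 2) ≤ n → 4 * suc n C k < 3 * n C suc k
    split-n le with m≤n⇒∃[o]m+o≡n (≤-trans (m≤m+n k (2 * k + 2)) le)
    ... | m , refl with m≤n⇒∃[o]m+o≡n (+-cancelˡ-≤ k (2 * k + 2) m le)
    ...   | t , refl = C-compare k (2 * k + 2 + t) 4 3 (<-by-slack _ (coeffs k t))

  nC[1+k]<[1+n]Ck : ∀ n k → 2 * (2 + n) < 5 * suc k → k ≤ suc n → n C suc k < suc n C k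
  nC[1+k]<[1+n]Ck n k lt k≤1+n with m≤n⇒m<n∨m≡n k≤1+n
  ... | inj₂ refl = subst (_< suc n C suc n) (sym (C-vanish (m<n⇒m<1+n (n<1+n n)))) (C-pos ≤-refl)
  ... | inj₁ (s≤s k≤n) with m≤n⇒∃[o]m+o≡n k≤n
  ...   | m , refl = C-compare′ k m (coeffs 2m≤3k)
    where
    2m≤3k : m + m ≤ 3 * k
    2m≤3k = +-cancelʳ-≤ (2 * k + 5) (m + m) (3 * k) (subst₂ _≤_ (split₁ k m) (split₂ k) lt)
      where
      split₁ : ∀ k m → suc (2 * (2 + (k + m))) ≡ (m + m) + (2 * k + 5)
      split₁ = solve-∀
      split₂ : ∀ k → 5 * suc k ≡ 3 * k + (2 * k + 5)
      split₂ = solve-∀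
    coeffs : m + m ≤ 3 * k → suc m * m < suc k * suc (k + m)
    coeffs 2m≤3k = *-cancelˡ-< 4 (suc m * m) _ (begin-strict
      4 * (suc m * m)                           ≡⟨ expand₁ m ⟩
      (m + m) * (m + m) + 4 * m                 ≤⟨ +-monoˡ-≤ (4 * m) (*-monoʳ-≤ (m + m) 2m≤3k) ⟩
      (m + m) * (3 * k) + 4 * m                 ≡⟨ cong (_+ 4 * m) (expand₂ m k) ⟩
      4 * (k * m) + k * (m + m) + 4 * m         ≤⟨ +-monoˡ-≤ (4 * m) (+-monoʳ-≤ (4 * (k * m)) (*-monoʳ-≤ k 2m≤3k)) ⟩
      4 * (k * m) + k * (3 * k) + 4 * m         <⟨ <-by-slack _ (expand₃ k m) ⟩
      4 * (suc k * suc (k + m))                 ∎)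
      where
      open ≤-Reasoning
      expand₁ : ∀ m → 4 * (suc m * m) ≡ (m + m) * (m + m) + 4 * m
      expand₁ = solve-∀
      expand₂ : ∀ m k → (m + m) * (3 * k) ≡ 4 * (k * m) + k * (m + m)
      expand₂ = solve-∀
      expand₃ : ∀ k m → 4 * (k * m) + k * (3 * k) + 4 * m + suc (k * k + 8 * k + 3) ≡ 4 * (suc k * suc (k + m))
      expand₃ = solve-∀

  [1+n]Ck+C-pair<nC[1+k] : ∀ n h k → 2 ≤ h → h + h ≤ n + 2 → 7 ≤ n → 1 ≤ k → 3 * k + 2 ≤ n →
               suc n C k + C-pair h (suc k) < n C suc k
  [1+n]Ck+C-pair<nC[1+k] n (suc g) 1 _ le 7≤n _ _ with m≤n⇒∃[o]m+o≡n 7≤n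
  ... | t , refl = *-cancelˡ-< 4 _ _ (begin-strict
    4 * (suc n C 1 + C-pair (suc g) 2)    ≡⟨ cong (λ z → 4 * z) (cong₂ _+_ (nC1≡n (suc n)) (C-pair[1+g]2≡g*g g)) ⟩
    4 * (suc n + g * g)                   ≡⟨ expand (suc n) g ⟩
    4 * suc n + (g + g) * (g + g)         ≤⟨ +-monoʳ-≤ (4 * suc n) (*-mono-≤ 2g≤n 2g≤n) ⟩
    4 * suc n + n * n                     <⟨ <-by-slack (2 + 8 * t + t * t) (polynomial t) ⟩
    2 * (suc (6 + t) * (6 + t))           ≡⟨ cong (2 *_) (sym (2*[1+m]C2≡[1+m]*m (6 + t))) ⟩
    2 * (2 * n C 2)                       ≡⟨ sym (*-assoc 2 2 (n C 2)) ⟩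
    4 * n C 2                             ∎)
    where
    open ≤-Reasoning
    2g≤n : g + g ≤ n
    2g≤n = +-cancelʳ-≤ 2 (g + g) n (subst (_≤ n + 2) (regroup g) le)
      where
      regroup : ∀ g → suc g + suc g ≡ g + g + 2
      regroup = solve-∀
    expand : ∀ a g → 4 * (a + g * g) ≡ 4 * a + (g + g) * (g + g)
    expand = solve-∀
    polynomial : ∀ t → 4 * suc (7 + t) + (7 + t) * (7 + t) + suc (2 + 8 * t + t * t) ≡ 2 * (suc (6 + t) * (6 + t))
    polynomial = solve-∀
  [1+n]Ck+C-pair<nC[1+k] n h (suc (suc i)) 2≤h le _ _ 3k+2≤n = *-cancelˡ-< 4 _ _ (begin-strict
    4 * (Y + C-pair h (3 + i))            ≡⟨ *-distribˡ-+ 4 Y _ ⟩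
    4 * Y + 4 * C-pair h (3 + i)          <⟨ +-mono-<-≤ (4*[1+n]Ck<3*nC[1+k] n (2 + i) 3k+2≤n) (C-pair-quarter i 2≤h le) ⟩
    3 * X + X                             ≡⟨ +-comm (3 * X) X ⟩
    4 * X                                 ∎)
    where
    open ≤-Reasoning
    X = n C (3 + i)
    Y = suc n C (2 + i)

  Halves : ℕ → ℕ → Set
  Halves n h = n ≡ h + h ⊎ n ≡ suc (h + h)

  [2+n]/2≡1+n/2 : ∀ n → (2 + n) / 2 ≡ suc (n / 2)
  [2+n]/2≡1+n/2 n = m/n≡1+[m∸n]/n {2 + n} (s≤s (s≤s z≤n))

  /2-halves : ∀ n → Halves n (n / 2)
  /2-halves 0 = inj₁ refl
  /2-halves 1 = inj₂ refl
  /2-halves (suc (suc n)) rewrite [2+n]/2≡1+n/2 n with /2-halves n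
  ... | inj₁ n≡2h = inj₁ (trans (cong (2 +_) n≡2h) (cong suc (sym (+-suc (n / 2) (n / 2)))))
  ... | inj₂ n≡2h+1 = inj₂ (trans (cong (2 +_) n≡2h+1) (cong (2 +_) (sym (+-suc (n / 2) (n / 2)))))

  halves-≤ : ∀ {n h} → Halves n h → h + h ≤ n
  halves-≤ (inj₁ refl) = ≤-refl
  halves-≤ (inj₂ refl) = n≤1+n _

  halves-≥ : ∀ {n h m} → Halves n h → m + m ≤ n → m ≤ h
  halves-≥ {n} {h} {m} n≡2h 2m≤n with ≤-<-connex m h
  ... | inj₁ m≤h = m≤h
  ... | inj₂ h<m = contradiction (≤-trans 2m≤n (n≤2h+1 n≡2h)) (<⇒≱ (subst (_≤ m + m) (cong suc (+-suc h h)) (+-mono-≤ h<m h<m)))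
    where
    n≤2h+1 : Halves n h → n ≤ suc (h + h)
    n≤2h+1 (inj₁ refl) = n≤1+n _
    n≤2h+1 (inj₂ refl) = ≤-refl

  C-pair-≤-halves : ∀ e g j → Halves e g → 1 ≤ e → C-pair (2 + g) (2 + j) ≤ e C j + suc e C (2 + j)
  C-pair-≤-halves .(suc (g + g)) g j (inj₂ refl) _ = ≤-trans (C-pair-≤-double g j) (m≤n+m _ _)
  C-pair-≤-halves .(0 + 0) zero j (inj₁ refl) ()
  C-pair-≤-halves .(suc x + suc x) (suc x) j (inj₁ refl) _ = begin
    C-pair (3 + x) (2 + j)
      ≡⟨ cong₂ _+_ (C-pascal₂ (suc x) j) (C-pascal (suc x) (suc j)) ⟩
    (a + 2 * b + c) + (b + c)
      ≡⟨ regroup a b c ⟩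
    a + ((b + c) + c + 2 * b)
      ≡⟨ cong (λ z → a + (z + c + 2 * b)) (sym (C-pascal (suc x) (suc j))) ⟩
    a + ((2 + x) C (2 + j) + c + 2 * b)
      ≤⟨ +-mono-≤ (C-monoˡ-≤ j (s≤s (m≤m+n x (suc x)))) (C-vandermonde-≤ x (suc x) j) ⟩
    (suc x + suc x) C j + suc (suc x + suc x) C (2 + j) ∎
    where
    open ≤-Reasoning
    a = suc x C j
    b = suc x C suc j
    c = suc x C (2 + j)
    regroup : ∀ a b c → (a + 2 * b + c) + (b + c) ≡ a + ((b + c) + c + 2 * b)
    regroup = solve-∀

  C-pair+[1+e]C[1+j]+eC[1+j]<[3+e]C[2+j] : ∀ e g j → Halves e g → 1 ≤ e → j ≤ suc e →
                 C-pair (2 + g) (2 + j) + suc e C suc j + e C suc j < (3 + e) C (2 + j)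
  C-pair+[1+e]C[1+j]+eC[1+j]<[3+e]C[2+j] e g j e≡2g 1≤e j≤1+e = begin-strict
    C-pair (2 + g) (2 + j) + A + e C suc j
      ≤⟨ +-monoˡ-≤ (e C suc j) (+-monoˡ-≤ A (C-pair-≤-halves e g j e≡2g 1≤e)) ⟩
    e C j + suc e C (2 + j) + A + e C suc j
      <⟨ m<n+m _ (C-pos j≤1+e) ⟩
    suc e C j + (e C j + suc e C (2 + j) + A + e C suc j)
      ≡⟨ cong (λ z → suc e C j + (e C j + suc e C (2 + j) + z + e C suc j)) (C-pascal e j) ⟩
    suc e C j + (e C j + suc e C (2 + j) + (e C j + e C suc j) + e C suc j)
      ≡⟨ regroup (suc e C j) (e C j) (suc e C (2 + j)) (e C suc j) ⟩
    suc e C j + 2 * (e C j + e C suc j) + suc e C (2 + j)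
      ≡⟨ cong (λ z → suc e C j + 2 * z + suc e C (2 + j)) (sym (C-pascal e j)) ⟩
    suc e C j + 2 * A + suc e C (2 + j)
      ≡⟨ sym (C-pascal₂ (suc e) j) ⟩
    (3 + e) C (2 + j) ∎
    where
    open ≤-Reasoning
    A = suc e C suc j
    regroup : ∀ a b f c → a + (b + f + (b + c) + c) ≡ a + 2 * (b + c) + f
    regroup = solve-∀

  <-by-slack-≤ : ∀ {P S R} → P + S ≤ R → 0 < S → P < R
  <-by-slack-≤ {P} le 0<S = <-≤-trans (m<m+n P 0<S) le

  C-pair<[d∸2]C[2+j]+[d∸2]Cj : ∀ d h j → h + h ≤ d → 2 ≤ h → suc j ≤ d ∸ 2 → C-pair h (2 + j) < (d ∸ 2) C (2 + j) + (d ∸ 2) C j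
  C-pair<[d∸2]C[2+j]+[d∸2]Cj d 1 j _ (s≤s ()) _
  C-pair<[d∸2]C[2+j]+[d∸2]Cj d (suc (suc a)) j le _ j<d∸2 = begin-strict
    C-pair (2 + a) (2 + j)       ≤⟨ C-pair-≤-double a j ⟩
    (2 + (a + a)) C (2 + j)      ≤⟨ C-monoˡ-≤ (2 + j) (m+n≤o⇒m≤o∸n (2 + (a + a)) (subst (_≤ d) (regroup a) le)) ⟩
    (d ∸ 2) C (2 + j)            <⟨ m<m+n _ (C-pos (<⇒≤ j<d∸2)) ⟩
    (d ∸ 2) C (2 + j) + (d ∸ 2) C j ∎
    where
    open ≤-Reasoning
    regroup : ∀ a → suc (suc a) + suc (suc a) ≡ (2 + (a + a)) + 2
    regroup = solve-∀

  C-pair-<-C-double : ∀ x j → j ≤ 2 + (x + x) → C-pair (3 + x) (2 + j) < (4 + (x + x)) C (2 + j)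
  C-pair-<-C-double x j j≤2+2x with ≤-<-connex j (suc x)
  ... | inj₁ j≤1+x = <-by-slack-≤ (begin
    C-pair (3 + x) (2 + j) + b                          ≡⟨ cong (λ z → z + c + b) (C-pascal (suc (suc x)) (suc j)) ⟩
    b + c + c + b                                       ≡⟨ regroup b c ⟩
    c + c + 2 * b                                       ≤⟨ C-vandermonde-≤ x (2 + x) j ⟩
    (2 + (x + (2 + x))) C (2 + j)                       ≡⟨ cong (λ z → (2 + z) C (2 + j)) (shift x) ⟩
    (4 + (x + x)) C (2 + j)                             ∎) (C-pos (s≤s j≤1+x))
    where
    open ≤-Reasoning
    b = (2 + x) C (1 + j)
    c = (2 + x) C (2 + j)
    regroup : ∀ b c → b + c + c + b ≡ c + c + 2 * b
    regroup = solve-∀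
    shift : ∀ x → x + (2 + x) ≡ 2 + (x + x)
    shift = solve-∀
  ... | inj₂ 1+x<j = subst (_< (4 + (x + x)) C (2 + j)) (sym (cong₂ _+_ (C-vanish (s≤s (s≤s 1+x<j))) (C-vanish (s≤s (s≤s (≤-trans (n≤1+n _) 1+x<j))))))
                       (C-pos (s≤s (s≤s j≤2+2x)))

  C-pair-<-C-double-pred : ∀ x j → j ≤ 3 + (x + x) → C-pair (4 + x) (2 + j) < (5 + (x + x)) C (2 + j)
  C-pair-<-C-double-pred x j j≤3+2x with ≤-<-connex j (2 + x)
  ... | inj₁ j≤2+x = <-by-slack-≤ (begin
    C-pair (4 + x) (2 + j) + a
      ≡⟨ cong (λ z → z + (3 + x) C (2 + j) + a) (C-pascal (3 + x) (1 + j)) ⟩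
    (3 + x) C (1 + j) + (3 + x) C (2 + j) + (3 + x) C (2 + j) + a
      ≡⟨ cong (λ z → (3 + x) C (1 + j) + z + z + a) (C-pascal (2 + x) (1 + j)) ⟩
    (3 + x) C (1 + j) + (b + c) + (b + c) + a
      ≡⟨ cong (λ z → z + (b + c) + (b + c) + a) (C-pascal (2 + x) j) ⟩
    (a + b) + (b + c) + (b + c) + a
      ≡⟨ regroup a b c ⟩
    c + (b + c) + 2 * (a + b)
      ≡⟨ cong₂ (λ u v → c + u + 2 * v) (sym (C-pascal (2 + x) (1 + j))) (sym (C-pascal (2 + x) j)) ⟩
    c + (3 + x) C (2 + j) + 2 * (3 + x) C (1 + j)
      ≤⟨ C-vandermonde-≤ x (3 + x) j ⟩
    (2 + (x + (3 + x))) C (2 + j)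
      ≡⟨ cong (λ z → (2 + z) C (2 + j)) (shift x) ⟩
    (5 + (x + x)) C (2 + j) ∎) (C-pos j≤2+x)
    where
    open ≤-Reasoning
    a = (2 + x) C j
    b = (2 + x) C (1 + j)
    c = (2 + x) C (2 + j)
    regroup : ∀ a b c → (a + b) + (b + c) + (b + c) + a ≡ c + (b + c) + 2 * (a + b)
    regroup = solve-∀
    shift : ∀ x → x + (3 + x) ≡ 3 + (x + x)
    shift = solve-∀
  ... | inj₂ 2+x<j = subst (_< (5 + (x + x)) C (2 + j))
                       (sym (cong₂ _+_ (C-vanish (s≤s (s≤s 2+x<j))) (C-vanish (s≤s (s≤s (≤-trans (n≤1+n _) 2+x<j))))))
                       (C-pos (s≤s (s≤s j≤3+2x)))

  C-pair+C-pair<[d∸2]C[2+j]+[d∸2]C[1+j] : ∀ d h j → Halves d h → 5 ≤ d → suc j ≤ d ∸ 2 →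
               C-pair h (2 + j) + C-pair h (1 + j) < (d ∸ 2) C (2 + j) + (d ∸ 2) C (1 + j)
  C-pair+C-pair<[d∸2]C[2+j]+[d∸2]C[1+j] _ 1 j (inj₁ refl) (s≤s (s≤s ())) _
  C-pair+C-pair<[d∸2]C[2+j]+[d∸2]C[1+j] _ 2 j (inj₁ refl) (s≤s (s≤s (s≤s (s≤s ())))) _
  C-pair+C-pair<[d∸2]C[2+j]+[d∸2]C[1+j] _ (suc (suc (suc x))) j (inj₁ refl) _ (s≤s j≤D) = begin-strict
    C-pair (3 + x) (2 + j) + C-pair (3 + x) (1 + j)   ≡⟨ trans (+-comm (C-pair (3 + x) (2 + j)) _) (sym (C-pair-pascal (2 + x) (1 + j))) ⟩
    C-pair (4 + x) (2 + j)                            <⟨ C-pair-<-C-double-pred x j (subst (j ≤_) (shift x) j≤D) ⟩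
    (5 + (x + x)) C (2 + j)                           ≡⟨ cong (λ z → suc (suc z) C (2 + j)) (sym (shift x)) ⟩
    suc D C (2 + j)                                   ≡⟨ trans (C-pascal D (1 + j)) (+-comm (D C (1 + j)) _) ⟩
    D C (2 + j) + D C (1 + j)                         ∎
    where
    open ≤-Reasoning
    D = suc (x + (3 + x))
    shift : ∀ x → x + (3 + x) ≡ 3 + (x + x)
    shift = solve-∀
  C-pair+C-pair<[d∸2]C[2+j]+[d∸2]C[1+j] _ 1 j (inj₂ refl) (s≤s (s≤s (s≤s ()))) _
  C-pair+C-pair<[d∸2]C[2+j]+[d∸2]C[1+j] _ (suc (suc x)) j (inj₂ refl) _ (s≤s j≤D) = begin-strict
    C-pair (2 + x) (2 + j) + C-pair (2 + x) (1 + j)   ≡⟨ trans (+-comm (C-pair (2 + x) (2 + j)) _) (sym (C-pair-pascal (1 + x) (1 + j))) ⟩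
    C-pair (3 + x) (2 + j)                            <⟨ C-pair-<-C-double x j (subst (j ≤_) (shift x) j≤D) ⟩
    (4 + (x + x)) C (2 + j)                           ≡⟨ cong (λ z → suc (suc z) C (2 + j)) (sym (shift x)) ⟩
    suc D C (2 + j)                                   ≡⟨ trans (C-pascal D (1 + j)) (+-comm (D C (1 + j)) _) ⟩
    D C (2 + j) + D C (1 + j)                         ∎
    where
    open ≤-Reasoning
    D = suc (x + (2 + x))
    shift : ∀ x → x + (2 + x) ≡ 2 + (x + x)
    shift = solve-∀

  3k+2≤n : ∀ n k → 1 ≤ k → k ≤ ⌈ 2 + n /3⌉ ∸ 2 → 3 * k + 2 ≤ n
  3k+2≤n n k 1≤k k≤x∸2 = +-cancelʳ-≤ 4 (3 * k + 2) n (begin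
    3 * k + 2 + 4      ≡⟨ regroup k ⟩
    (k + 2) * 3        ≤⟨ *-monoˡ-≤ 3 (m≤o∸n⇒m+n≤o k 2≤x k≤x∸2) ⟩
    x * 3              ≤⟨ m/n*n≤m (2 + n + 2) 3 ⟩
    2 + n + 2          ≡⟨ +-comm (2 + n) 2 ⟩
    4 + n              ≡⟨ +-comm 4 n ⟩
    n + 4              ∎)
    where
    open ≤-Reasoning
    x = ⌈ 2 + n /3⌉
    2≤x : 2 ≤ x
    2≤x = <⇒≤ (m∸n≢0⇒n<m (λ x∸2≡0 → contradiction (≤-trans 1≤k (subst (k ≤_) x∸2≡0 k≤x∸2)) λ ()))
    regroup : ∀ k → 3 * k + 2 + 4 ≡ (k + 2) * 3
    regroup = solve-∀

  m/5≤k⇒m<5[1+k] : ∀ m k → m / 5 ≤ k → m < 5 * suc k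
  m/5≤k⇒m<5[1+k] m k m/5≤k = begin-strict
    m                      ≡⟨ m≡m%n+[m/n]*n m 5 ⟩
    m % 5 + m / 5 * 5      <⟨ +-mono-<-≤ (m%n<n m 5) (*-monoˡ-≤ 5 m/5≤k) ⟩
    5 + k * 5              ≡⟨ regroup k ⟩
    5 * suc k              ∎
    where
    open ≤-Reasoning
    regroup : ∀ k → 5 + k * 5 ≡ 5 * suc k
    regroup = solve-∀


  estimate-i : ∀ d k → 9 ≤ d → 1 ≤ k → k ≤ ⌈ d /3⌉ ∸ 2 →
    d C suc k + (⌈ suc d /2⌉ ∸ 1) C suc k + (⌈ suc d /2⌉ ∸ 2) C suc k
      < (d ∸ 1) C suc k + (d ∸ 2) C suc k
  estimate-i (suc (suc n)) k (s≤s (s≤s 7≤n)) 1≤k k≤⌈d/3⌉∸2 rewrite [2+n]/2≡1+n/2 (2 + n) = begin-strict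
    (2 + n) C suc k + h C suc k + (h ∸ 1) C suc k         ≡⟨ +-assoc ((2 + n) C suc k) _ _ ⟩
    (2 + n) C suc k + C-pair h (suc k)                    ≡⟨ cong (_+ C-pair h (suc k)) (C-pascal (suc n) k) ⟩
    ((1 + n) C k + (1 + n) C suc k) + C-pair h (suc k)    ≡⟨ regroup ((1 + n) C k) _ _ ⟩
    (1 + n) C suc k + ((1 + n) C k + C-pair h (suc k))    <⟨ +-monoʳ-< ((1 + n) C suc k) ([1+n]Ck+C-pair<nC[1+k] n h k 2≤h 2h≤n+2 7≤n 1≤k (3k+2≤n n k 1≤k k≤⌈d/3⌉∸2)) ⟩
    (1 + n) C suc k + n C suc k                           ∎
    where
    open ≤-Reasoning
    h = (2 + n) / 2
    2≤h : 2 ≤ h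
    2≤h = halves-≥ {h = h} (/2-halves (2 + n)) (s≤s (s≤s (≤-trans (s≤s (s≤s z≤n)) 7≤n)))
    2h≤n+2 : h + h ≤ n + 2
    2h≤n+2 = subst (h + h ≤_) (+-comm 2 n) (halves-≤ {h = h} (/2-halves (2 + n)))
    regroup : ∀ a b c → (a + b) + c ≡ b + (a + c)
    regroup = solve-∀

  estimate-ii : ∀ d k → 9 ≤ d → (2 * d) / 5 ≤ k → k ≤ d ∸ 1 →
    (d ∸ 1) C suc k + (d ∸ 2) C suc k < d C suc k + (⌈ suc d /2⌉ ∸ 1) C suc k + (⌈ suc d /2⌉ ∸ 2) C suc k
  estimate-ii (suc (suc n)) k (s≤s (s≤s _)) 2d/5≤k k≤1+n = begin-strict
    (1 + n) C suc k + n C suc k    <⟨ +-monoʳ-< ((1 + n) C suc k) (nC[1+k]<[1+n]Ck n k (m/5≤k⇒m<5[1+k] _ k 2d/5≤k) k≤1+n) ⟩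
    (1 + n) C suc k + (1 + n) C k  ≡⟨ trans (+-comm ((1 + n) C suc k) _) (sym (C-pascal (1 + n) k)) ⟩
    (2 + n) C suc k                ≤⟨ ≤-trans (m≤m+n _ _) (m≤m+n _ _) ⟩
    (2 + n) C suc k + (⌈ 3 + n /2⌉ ∸ 1) C suc k + (⌈ 3 + n /2⌉ ∸ 2) C suc k ∎
    where open ≤-Reasoning

  estimate-iii : ∀ d k → 6 ≤ d → 1 ≤ k → k ≤ d ∸ 3 →
    (⌈ d /2⌉ ∸ 1) C suc k + (⌈ d /2⌉ ∸ 2) C suc k + (d ∸ 4) C k + (d ∸ 5) C k < (d ∸ 2) C suc k
  estimate-iii (suc (suc (suc (suc (suc e))))) (suc j) (s≤s (s≤s (s≤s (s≤s (s≤s 1≤e))))) _ (s≤s j≤1+e)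
    rewrite [2+n]/2≡1+n/2 (4 + e) | [2+n]/2≡1+n/2 (2 + e) | [2+n]/2≡1+n/2 e =
    C-pair+[1+e]C[1+j]+eC[1+j]<[3+e]C[2+j] e (e / 2) j (/2-halves e) 1≤e j≤1+e

  E₃-terms-vanish : ∀ d k → 6 ≤ d → d ∸ 2 ≤ k →
    (d ∸ 2) C suc k ≡ 0 × (⌈ d /2⌉ ∸ 1) C suc k ≡ 0 × (⌈ d /2⌉ ∸ 2) C suc k ≡ 0 × (d ∸ 4) C k ≡ 0 × (d ∸ 5) C k ≡ 0
  E₃-terms-vanish (suc (suc (suc (suc (suc (suc e)))))) k (s≤s (s≤s (s≤s (s≤s (s≤s (s≤s _)))))) 4+e≤k
    rewrite [2+n]/2≡1+n/2 (5 + e) | [2+n]/2≡1+n/2 (3 + e) | [2+n]/2≡1+n/2 (1 + e) =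
    C-vanish (s≤s 4+e≤k) , C-vanish (s≤s (≤k (s≤s (s≤s (m≤n⇒m≤1+n g≤1+e))))) ,
    C-vanish (s≤s (≤k (s≤s (m≤n⇒m≤1+n (m≤n⇒m≤1+n g≤1+e))))) ,
    C-vanish (≤k (n≤1+n (3 + e))) , C-vanish (≤k (≤-trans (n≤1+n (2 + e)) (n≤1+n (3 + e))))
    where
    g≤1+e : (1 + e) / 2 ≤ 1 + e
    g≤1+e = m/n≤m (1 + e) 2
    ≤k : ∀ {m} → m ≤ 4 + e → m ≤ k
    ≤k m≤4+e = ≤-trans m≤4+e 4+e≤k

  estimate-iv : ∀ d j → 4 ≤ d → suc j ≤ d ∸ 2 →
    ⌈ d ∸ 1 /2⌉ C (2 + j) + (⌈ d ∸ 1 /2⌉ ∸ 1) C (2 + j) < (d ∸ 2) C (2 + j) + (d ∸ 2) C j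
  estimate-iv (suc e) j 4≤d j<d∸2 =
    C-pair<[d∸2]C[2+j]+[d∸2]Cj (suc e) h j (halves-≤ {h = h} (/2-halves (suc e))) (halves-≥ {h = h} (/2-halves (suc e)) 4≤d) j<d∸2
    where h = suc e / 2

  estimate-v : ∀ d j → 5 ≤ d → suc j ≤ d ∸ 2 →
    ⌈ d ∸ 1 /2⌉ C (2 + j) + (⌈ d ∸ 1 /2⌉ ∸ 1) C (2 + j) + ⌈ d ∸ 1 /2⌉ C (1 + j) + (⌈ d ∸ 1 /2⌉ ∸ 1) C (1 + j)
      < (d ∸ 2) C (2 + j) + (d ∸ 2) C (1 + j)
  estimate-v (suc e) j 5≤d j<d∸2 =
    subst (_< (suc e ∸ 2) C (2 + j) + (suc e ∸ 2) C (1 + j)) (sym (+-assoc (C-pair h (2 + j)) (h C (1 + j)) _))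
          (C-pair+C-pair<[d∸2]C[2+j]+[d∸2]C[1+j] (suc e) h j (/2-halves (suc e)) 5≤d j<d∸2)
    where h = suc e / 2

open import Defs
open import Data.Nat as ℕ using (ℕ; _≤_; _∸_; _/_; _*_)
open import Data.Integer as ℤ using (ℤ; _+_)
open import Data.Product using (_×_; _,_)
open import Relation.Binary.PropositionalEquality using (_≡_)

open BinomialEstimates using (estimate-i; estimate-ii; estimate-iii; E₃-terms-vanish; estimate-iv; estimate-v)

open import Data.Nat using (suc; s≤s; z≤n)
open import Data.Nat.Properties using (≤-refl; ∸-monoʳ-≤)
open import Data.Nat.Combinatorics using (nCk+nC[k+1]≡[n+1]C[k+1])
open import Data.Integer using (_-_; _<_; +<+)
open import Data.Integer.Properties using (+-monoˡ-<)
open import Data.Integer.Tactic.RingSolver using (solve-∀)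
open import Relation.Binary.PropositionalEquality using (refl; subst₂; trans; cong; sym)

<-from-gap : ∀ {L R X Y : ℤ} → R - L ≡ Y - X → X < Y → L < R
<-from-gap {L} {R} {X} {Y} gap X<Y = subst₂ _<_ (cancel L X) (trans (shift L X Y) (trans (cong (L +_) (sym gap)) (cancel′ L R)))
  (+-monoˡ-< (L - X) X<Y)
  where
  cancel : ∀ L X → X + (L - X) ≡ L
  cancel = solve-∀
  shift : ∀ L X Y → Y + (L - X) ≡ L + (Y - X)
  shift = solve-∀
  cancel′ : ∀ L R → L + (R - L) ≡ R
  cancel′ = solve-∀

B-pascal : ∀ n k → B (suc n) (suc k) ≡ B n k + B n (suc k)
B-pascal n k = cong ℤ.+_ (sym (nCk+nC[k+1]≡[n+1]C[k+1] n k))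

τ₁-η₁ : ∀ d k → τ₁ d k - η₁ d k
  ≡ (B (d ∸ 1) (suc k) + B (d ∸ 2) (suc k)) - (B d (suc k) + B (⌈ suc d /2⌉ ∸ 1) (suc k) + B (⌈ suc d /2⌉ ∸ 2) (suc k))
τ₁-η₁ d k = gap (B (suc d) (suc k)) (B d (suc k)) (B (d ∸ 1) (suc k)) (B (d ∸ 2) (suc k))
                (B (⌈ suc d /2⌉ ∸ 1) (suc k)) (B (⌈ suc d /2⌉ ∸ 2) (suc k))
  where
  gap : ∀ a b c e f g → (a + b + c - f - g) - (a + ℤ.+ 2 ℤ.* b - e) ≡ (c + e) - (b + f + g)
  gap = solve-∀

η₁-τ₁ : ∀ d k → η₁ d k - τ₁ d k
  ≡ (B d (suc k) + B (⌈ suc d /2⌉ ∸ 1) (suc k) + B (⌈ suc d /2⌉ ∸ 2) (suc k)) - (B (d ∸ 1) (suc k) + B (d ∸ 2) (suc k))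
η₁-τ₁ d k = gap (B (suc d) (suc k)) (B d (suc k)) (B (d ∸ 1) (suc k)) (B (d ∸ 2) (suc k))
                (B (⌈ suc d /2⌉ ∸ 1) (suc k)) (B (⌈ suc d /2⌉ ∸ 2) (suc k))
  where
  gap : ∀ a b c e f g → (a + ℤ.+ 2 ℤ.* b - e) - (a + b + c - f - g) ≡ (b + f + g) - (c + e)
  gap = solve-∀

E₃-gap : ∀ d k → E₃ d k - ℤ.0ℤ
  ≡ B (d ∸ 2) (suc k) - (B (⌈ d /2⌉ ∸ 1) (suc k) + B (⌈ d /2⌉ ∸ 2) (suc k) + B (d ∸ 4) k + B (d ∸ 5) k)
E₃-gap d k = gap (B (d ∸ 2) (suc k)) (B (⌈ d /2⌉ ∸ 1) (suc k)) (B (⌈ d /2⌉ ∸ 2) (suc k)) (B (d ∸ 4) k) (B (d ∸ 5) k)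
  where
  gap : ∀ c f g h i → (c - f - g - h - i) - ℤ.0ℤ ≡ c - (f + g + h + i)
  gap = solve-∀

signed-sum-of-zeros : ∀ {c f g h i : ℕ} → c ≡ 0 → f ≡ 0 → g ≡ 0 → h ≡ 0 → i ≡ 0 →
       ℤ.+ c - ℤ.+ f - ℤ.+ g - ℤ.+ h - ℤ.+ i ≡ ℤ.0ℤ
signed-sum-of-zeros refl refl refl refl refl = refl

-- x, w, v, u are the rows 3 + e, 2 + e, 1 + e, e of Pascal's triangle (uᵢ = B e (i + j)),
-- all expanded down to row e.
τ₂+η₂-η₁ : ∀ e j → (τ₂ (suc (suc e)) (suc j) + η₂ (suc (suc e)) j + B (suc e) (suc j) + B e (suc j)) - η₁ (suc (suc e)) (suc j)
  ≡ (B e (suc (suc j)) + B e j) - (B ⌈ suc e /2⌉ (suc (suc j)) + B (⌈ suc e /2⌉ ∸ 1) (suc (suc j)))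
τ₂+η₂-η₁ e j = gap (B e j) (B e (suc j)) (B e (suc (suc j))) (B (suc (suc e)) (suc j))
                     (B ⌈ suc e /2⌉ (suc (suc j))) (B (⌈ suc e /2⌉ ∸ 1) (suc (suc j)))
                     (B-pascal (suc (suc e)) (suc j)) (B-pascal (suc e) (suc j)) (B-pascal e (suc j)) (B-pascal e j)
  where
  gap : ∀ u₀ u₁ u₂ w₁ f g {x₂ w₂ v₁ v₂} → x₂ ≡ w₁ + w₂ → w₂ ≡ v₁ + v₂ → v₂ ≡ u₁ + u₂ → v₁ ≡ u₀ + u₁ →
        ((w₂ + v₂ + u₂ - f - g) + (w₁ + ℤ.+ 2 ℤ.* v₁ - u₁) + v₁ + u₁) - (x₂ + ℤ.+ 2 ℤ.* w₂ - u₂) ≡ (u₂ + u₀) - (f + g)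
  gap u₀ u₁ u₂ w₁ f g refl refl refl refl = identity w₁ u₀ u₁ u₂ f g
    where
    identity : ∀ w₁ u₀ u₁ u₂ f g →
      let v₁ = u₀ + u₁; v₂ = u₁ + u₂; w₂ = v₁ + v₂ in
      ((w₂ + v₂ + u₂ - f - g) + (w₁ + ℤ.+ 2 ℤ.* v₁ - u₁) + v₁ + u₁) - ((w₁ + w₂) + ℤ.+ 2 ℤ.* w₂ - u₂) ≡ (u₂ + u₀) - (f + g)
    identity = solve-∀

τ₂+τ₂-η₁ : ∀ e j → (τ₂ (suc (suc e)) (suc j) + τ₂ (suc (suc e)) j + B (suc e) (suc j) + B e (suc j)) - η₁ (suc (suc e)) (suc j)
  ≡ (B e (suc (suc j)) + B e (suc j))
    - (B ⌈ suc e /2⌉ (suc (suc j)) + B (⌈ suc e /2⌉ ∸ 1) (suc (suc j)) + B ⌈ suc e /2⌉ (suc j) + B (⌈ suc e /2⌉ ∸ 1) (suc j))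
τ₂+τ₂-η₁ e j = gap (B e j) (B e (suc j)) (B e (suc (suc j))) (B (suc (suc e)) (suc j))
                     (B ⌈ suc e /2⌉ (suc (suc j))) (B (⌈ suc e /2⌉ ∸ 1) (suc (suc j)))
                     (B ⌈ suc e /2⌉ (suc j)) (B (⌈ suc e /2⌉ ∸ 1) (suc j))
                     (B-pascal (suc (suc e)) (suc j)) (B-pascal (suc e) (suc j)) (B-pascal e (suc j)) (B-pascal e j)
  where
  gap : ∀ u₀ u₁ u₂ w₁ f g f′ g′ {x₂ w₂ v₁ v₂} → x₂ ≡ w₁ + w₂ → w₂ ≡ v₁ + v₂ → v₂ ≡ u₁ + u₂ → v₁ ≡ u₀ + u₁ →
        ((w₂ + v₂ + u₂ - f - g) + (w₁ + v₁ + u₁ - f′ - g′) + v₁ + u₁) - (x₂ + ℤ.+ 2 ℤ.* w₂ - u₂)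
          ≡ (u₂ + u₁) - (f + g + f′ + g′)
  gap u₀ u₁ u₂ w₁ f g f′ g′ refl refl refl refl = identity w₁ u₀ u₁ u₂ f g f′ g′
    where
    identity : ∀ w₁ u₀ u₁ u₂ f g f′ g′ →
      let v₁ = u₀ + u₁; v₂ = u₁ + u₂; w₂ = v₁ + v₂ in
      ((w₂ + v₂ + u₂ - f - g) + (w₁ + v₁ + u₁ - f′ - g′) + v₁ + u₁) - ((w₁ + w₂) + ℤ.+ 2 ℤ.* w₂ - u₂)
        ≡ (u₂ + u₁) - (f + g + f′ + g′)
    identity = solve-∀

-- The estimates are stated with the sealed binomial; only here is it identified with the one in B.
opaque
  unfolding BinomialEstimates._C_

  part-i : (d k : ℕ) → 9 ≤ d → 1 ≤ k → k ≤ ⌈ d /3⌉ ∸ 2 → η₁ d k < τ₁ d k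
  part-i d k 9≤d 1≤k k≤⌈d/3⌉∸2 = <-from-gap (τ₁-η₁ d k) (+<+ (estimate-i d k 9≤d 1≤k k≤⌈d/3⌉∸2))

  part-ii : (d k : ℕ) → 9 ≤ d → (2 * d) / 5 ≤ k → k ≤ d ∸ 1 → τ₁ d k < η₁ d k
  part-ii d k 9≤d 2d/5≤k k≤d∸1 = <-from-gap (η₁-τ₁ d k) (+<+ (estimate-ii d k 9≤d 2d/5≤k k≤d∸1))

  part-iii : (d k : ℕ) → 6 ≤ d → 1 ≤ k → k ≤ d ∸ 3 → ℤ.0ℤ < E₃ d k
  part-iii d k 6≤d 1≤k k≤d∸3 = <-from-gap (E₃-gap d k) (+<+ (estimate-iii d k 6≤d 1≤k k≤d∸3))

  part-iii-zero : (d : ℕ) → 6 ≤ d → E₃ d (d ∸ 2) ≡ ℤ.0ℤ × E₃ d (d ∸ 1) ≡ ℤ.0ℤ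
  part-iii-zero d 6≤d = vanish (d ∸ 2) ≤-refl , vanish (d ∸ 1) (∸-monoʳ-≤ d (s≤s z≤n))
    where
    vanish : ∀ k → d ∸ 2 ≤ k → E₃ d k ≡ ℤ.0ℤ
    vanish k d∸2≤k with E₃-terms-vanish d k 6≤d d∸2≤k
    ... | c≡0 , f≡0 , g≡0 , h≡0 , i≡0 = signed-sum-of-zeros c≡0 f≡0 g≡0 h≡0 i≡0

  part-iv : (d k : ℕ) → 4 ≤ d → 1 ≤ k → k ≤ d ∸ 2 → η₁ d k < τ₂ d k + η₂ d (k ∸ 1) + B (d ∸ 1) k + B (d ∸ 2) k
  part-iv (suc (suc e)) (suc j) 4≤d _ k≤d∸2 = <-from-gap (τ₂+η₂-η₁ e j) (+<+ (estimate-iv (suc (suc e)) j 4≤d k≤d∸2))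

  part-v : (d k : ℕ) → 5 ≤ d → 1 ≤ k → k ≤ d ∸ 2 → η₁ d k < τ₂ d k + τ₂ d (k ∸ 1) + B (d ∸ 1) k + B (d ∸ 2) k
  part-v (suc (suc e)) (suc j) 5≤d _ k≤d∸2 = <-from-gap (τ₂+τ₂-η₁ e j) (+<+ (estimate-v (suc (suc e)) j 5≤d k≤d∸2))

lemma5p2 :
    ((d k : ℕ) → 9 ≤ d → 1 ≤ k → k ≤ ⌈ d /3⌉ ∸ 2 → η₁ d k ℤ.< τ₁ d k)
    × ((d k : ℕ) → 9 ≤ d → (2 * d) / 5 ≤ k → k ≤ d ∸ 1 → τ₁ d k ℤ.< η₁ d k)
    × ((d k : ℕ) → 6 ≤ d → 1 ≤ k → k ≤ d ∸ 3 → ℤ.0ℤ ℤ.< E₃ d k)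
    × ((d : ℕ) → 6 ≤ d → E₃ d (d ∸ 2) ≡ ℤ.0ℤ × E₃ d (d ∸ 1) ≡ ℤ.0ℤ)
    × ((d k : ℕ) → 4 ≤ d → 1 ≤ k → k ≤ d ∸ 2
       → η₁ d k ℤ.< τ₂ d k + η₂ d (k ∸ 1) + B (d ∸ 1) k + B (d ∸ 2) k)
    × ((d k : ℕ) → 5 ≤ d → 1 ≤ k → k ≤ d ∸ 2
       → η₁ d k ℤ.< τ₂ d k + τ₂ d (k ∸ 1) + B (d ∸ 1) k + B (d ∸ 2) k)
lemma5p2 = part-i , part-ii , part-iii , part-iii-zero , part-iv , part-v
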